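{- Let $1/2\le\varepsilon\le 1$ and $\delta=1/(2-\varepsilon)$. For each integer $n\ge 2$ there is a cograph $G$ with $2n$ vertices such that, whenever $X\subseteq V(G)$ and one of $G[X]$, $\overline{G}[X]$ has maximum degree at most $\varepsilon\delta|G|$, we have $|X|\le\delta|G|+1$ (and hence $|X|\le\lfloor\delta|G|+1\rfloor$).
   Context: All graphs are finite and simple; $|G|$ is the number of vertices, $G[X]$ the induced subgraph on $X$, $\overline{G}$ the complement. A cograph is a graph with no induced subgraph isomorphic to $P_4$, the path on four vertices.
   Formalization: The parameter ε ranges over the rationals between 1/2 and 1, so δ = 1/(2−ε) is rational as well. -}

module Defs where

open import Data.Bool using (Bool; true; false; not; _∧_)
open import Data.Nat using (ℕ)
open import Data.Integer using (+_)
open import Data.Fin using (Fin; zero; suc; _≟_)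
open import Data.Fin.Subset using (Subset; _∈_; _∩_; ∣_∣)
open import Data.Vec using (tabulate)
open import Data.Rational using (ℚ; _/_; _≤_; _*_)
open import Relation.Nullary.Decidable using (⌊_⌋)
open import Relation.Binary.PropositionalEquality using (_≡_)
open import Function.Definitions using (Injective)

record Graph (m : ℕ) : Set where
  field
    adj   : Fin m → Fin m → Bool
    sym   : ∀ x y → adj x y ≡ adj y x
    irrefl : ∀ x → adj x x ≡ false
open Graph public

complement : ∀ {m} → Graph m → Graph m
complement {m} G = record
  { adj = λ x y → not ⌊ x ≟ y ⌋ ∧ not (adj G x y)
  ; sym = symC
  ; irrefl = irrC
  }
  where
  open import Relation.Binary.PropositionalEquality using (refl; cong₂; cong)
  open import Relation.Nullary using (yes; no)
  symC : ∀ x y → (not ⌊ x ≟ y ⌋ ∧ not (adj G x y)) ≡ (not ⌊ y ≟ x ⌋ ∧ not (adj G y x))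
  symC x y with x ≟ y | y ≟ x
  ... | yes _ | yes _ = refl
  ... | no _ | no _ = cong not (sym G x y)
  ... | yes refl | no q with () ← q refl
  ... | no p | yes refl with () ← p refl
  irrC : ∀ x → (not ⌊ x ≟ x ⌋ ∧ not (adj G x x)) ≡ false
  irrC x with x ≟ x
  ... | yes _ = refl
  ... | no p with () ← p refl

P4adj : Fin 4 → Fin 4 → Bool
P4adj zero (suc zero) = true
P4adj (suc zero) zero = true
P4adj (suc zero) (suc (suc zero)) = true
P4adj (suc (suc zero)) (suc zero) = true
P4adj (suc (suc zero)) (suc (suc (suc zero))) = true
P4adj (suc (suc (suc zero))) (suc (suc zero)) = true
P4adj _ _ = false

record InducedP4 {m : ℕ} (G : Graph m) : Set where
  field
    f   : Fin 4 → Fin m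
    inj : Injective _≡_ _≡_ f
    pres : ∀ i j → adj G (f i) (f j) ≡ P4adj i j

IsCograph : ∀ {m} → Graph m → Set
IsCograph G = InducedP4 G → ⊥'
  where open import Data.Empty renaming (⊥ to ⊥')

nbhd : ∀ {m} → Graph m → Fin m → Subset m
nbhd G x = tabulate (adj G x)

degIn : ∀ {m} → Graph m → Subset m → Fin m → ℕ
degIn G X x = ∣ X ∩ nbhd G x ∣

ℕtoℚ : ℕ → ℚ
ℕtoℚ k = + k / 1

MaxDegInducedLe : ∀ {m} → Graph m → Subset m → ℚ → Set
MaxDegInducedLe G X t = ∀ x → x ∈ X → ℕtoℚ (degIn G X x) ≤ t

module Submission where

-- Take the threshold graph on 0, …, m − 1 in which an even vertex is adjacent to all later
-- vertices and an odd vertex to none of them; its complement is the same construction with the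
-- parities exchanged. It is a cograph: the lowest vertex of an induced P4 would see the other three
-- alike, whereas every vertex of P4 has a neighbour and a non-neighbour. Peeling off vertex 0
-- inductively, every nonempty X contains a vertex whose degree in G[X] (and likewise in the
-- complement) is at least 2|X| − m − 2. If all these degrees are at most εδm, this gives
-- 2|X| ≤ 2 + m + εδm = 2(δm + 1), because m = δ(2 − ε)m.

open import Defs hiding (sym)
open import Data.Bool using (Bool; true; false; not)
open import Data.Fin using (Fin)
open import Data.Fin.Subset using (Subset; ∣_∣)
open import Data.Product using (Σ; ∃; _×_; _,_)
open import Data.Sum using (_⊎_; inj₁; inj₂)
open import Relation.Binary.PropositionalEquality using (_≡_; _≢_; refl; sym; cong; cong₂; subst; subst₂; module ≡-Reasoning)

module ThresholdGraphs where

  open import Data.Bool.Properties using (∧-identityʳ)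
  open import Data.Fin using (zero; suc; _<_; _≟_)
  open import Data.Fin.Properties using (≤∧≢⇒<; ≤-totalOrder)
  open import Data.Fin.Subset using (_∈_; _∩_)
  open import Data.Fin.Subset.Properties using (∣p∣≤n)
  open import Data.List using (allFin)
  open import Data.List.Membership.Propositional.Properties using (∈-allFin)
  import Data.List.Relation.Unary.All as All
  import Data.List.Extrema as Extrema
  open import Data.Nat using (ℕ; suc; _+_; _≤_; z≤n; s≤s)
  open import Data.Nat.Properties using (+-suc; +-monoˡ-≤; +-monoʳ-≤; ≤-refl; ≤-trans; module ≤-Reasoning)
  import Data.Sum as Sum
  open import Data.Vec using (tabulate; []; _∷_; here; there)
  open import Data.Vec.Properties using (tabulate-cong)
  open import Function using (_∘_)
  open import Function.Definitions using (Injective)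
  open import Relation.Nullary using (yes; no; contradiction)

  alternating : ∀ {m} → Bool → Fin m → Fin m → Bool
  alternating b zero    zero    = false
  alternating b zero    (suc _) = b
  alternating b (suc _) zero    = b
  alternating b (suc i) (suc j) = alternating (not b) i j

  alternating-sym : ∀ {m} b (x y : Fin m) → alternating b x y ≡ alternating b y x
  alternating-sym b zero    zero    = refl
  alternating-sym b zero    (suc _) = refl
  alternating-sym b (suc _) zero    = refl
  alternating-sym b (suc i) (suc j) = alternating-sym (not b) i j

  alternating-irrefl : ∀ {m} b (x : Fin m) → alternating b x x ≡ false
  alternating-irrefl b zero    = refl
  alternating-irrefl b (suc x) = alternating-irrefl (not b) x

  Alternating : Bool → (m : ℕ) → Graph m
  Alternating b m = record
    { adj = alternating b ; sym = alternating-sym b ; irrefl = alternating-irrefl b }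

  not-alternating : ∀ {m} b {x y : Fin m} → x ≢ y →
                    not (alternating b x y) ≡ alternating (not b) x y
  not-alternating b {zero}  {zero}  0≢0 = contradiction refl 0≢0
  not-alternating b {zero}  {suc _} _   = refl
  not-alternating b {suc _} {zero}  _   = refl
  not-alternating b {suc i} {suc j} i≢j = not-alternating (not b) (i≢j ∘ cong suc)

  complement-Alternating : ∀ {m} b (x y : Fin m) →
                           adj (complement (Alternating b m)) x y ≡ alternating (not b) x y
  complement-Alternating b x y with x ≟ y
  ... | yes refl = sym (alternating-irrefl (not b) x)
  ... | no x≢y   = not-alternating b x≢y

  degIn-complement-Alternating : ∀ {m} b (X : Subset m) v →
    degIn (complement (Alternating b m)) X v ≡ degIn (Alternating (not b) m) X v
  degIn-complement-Alternating b X v =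
    cong (λ N → ∣ X ∩ N ∣) (tabulate-cong (complement-Alternating b v))

  ThresholdOrdered : ∀ {m} → Graph m → Set
  ThresholdOrdered G = ∀ {u v w} → u < v → u < w → adj G u v ≡ adj G u w

  alternating-thresholdOrdered : ∀ b {m} → ThresholdOrdered (Alternating b m)
  alternating-thresholdOrdered b {u = zero}  {suc _} {suc _} _         _         = refl
  alternating-thresholdOrdered b {u = suc _} {suc _} {suc _} (s≤s u<v) (s≤s u<w) =
    alternating-thresholdOrdered (not b) u<v u<w

  P4-neighbour-nonNeighbour : ∀ i → ∃ λ j → ∃ λ k →
    j ≢ i × k ≢ i × P4adj i j ≡ true × P4adj i k ≡ false
  P4-neighbour-nonNeighbour zero                   = suc zero , suc (suc zero) , (λ ()) , (λ ()) , refl , refl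
  P4-neighbour-nonNeighbour (suc zero)             = zero , suc (suc (suc zero)) , (λ ()) , (λ ()) , refl , refl
  P4-neighbour-nonNeighbour (suc (suc zero))       = suc zero , zero , (λ ()) , (λ ()) , refl , refl
  P4-neighbour-nonNeighbour (suc (suc (suc zero))) = suc (suc zero) , zero , (λ ()) , (λ ()) , refl , refl

  injective-strictArgmin : ∀ {k m} (f : Fin (suc k) → Fin m) → Injective _≡_ _≡_ f →
                     ∃ λ i → ∀ {j} → j ≢ i → f i < f j
  injective-strictArgmin {k} {m} f f-inj = i , λ {j} j≢i →
    ≤∧≢⇒< (All.lookup (f[argmin]≤f[xs] {f = f} zero (allFin (suc k))) (∈-allFin j)) (j≢i ∘ sym ∘ f-inj)
    where
    open Extrema (≤-totalOrder m) using (argmin; f[argmin]≤f[xs])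
    i = argmin f zero (allFin (suc k))

  thresholdOrdered⇒isCograph : ∀ {m} {G : Graph m} → ThresholdOrdered G → IsCograph G
  thresholdOrdered⇒isCograph {G = G} ordered P =
    let i , above                    = injective-strictArgmin f inj
        j , k , j≢i , k≢i , ij , ik  = P4-neighbour-nonNeighbour i
    in  contradiction (begin
          true              ≡⟨ sym ij ⟩
          P4adj i j         ≡⟨ sym (pres i j) ⟩
          adj G (f i) (f j) ≡⟨ ordered (above j≢i) (above k≢i) ⟩
          adj G (f i) (f k) ≡⟨ pres i k ⟩
          P4adj i k         ≡⟨ ik ⟩
          false             ∎) λ ()
    where
    open InducedP4 P
    open ≡-Reasoning

  alternating-isCograph : ∀ b {m} → IsCograph (Alternating b m)
  alternating-isCograph b = thresholdOrdered⇒isCograph (alternating-thresholdOrdered b)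

  DenseVertex : ∀ {m} → Graph m → ℕ → Subset m → Fin m → Set
  DenseVertex {m} G c X v = v ∈ X × ∣ X ∣ + ∣ X ∣ ≤ c + m + degIn G X v

  -- Alternating false starts with a vertex isolated from all later ones, which costs one more unit.
  slack : Bool → ℕ
  slack true  = 1
  slack false = 2

  slack≤2 : ∀ b → slack b ≤ 2
  slack≤2 true  = s≤s z≤n
  slack≤2 false = ≤-refl

  slack-not : ∀ b → slack (not b) ≤ suc (slack b)
  slack-not true  = ≤-refl
  slack-not false = s≤s z≤n

  ∩-tabulate-true : ∀ {m} (X : Subset m) → X ∩ tabulate (λ _ → true) ≡ X
  ∩-tabulate-true []      = refl
  ∩-tabulate-true (x ∷ X) = cong₂ _∷_ (∧-identityʳ x) (∩-tabulate-true X)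

  alternating-denseVertex : ∀ b {m} (X : Subset m) →
                            ∣ X ∣ ≡ 0 ⊎ ∃ (DenseVertex (Alternating b m) (slack b) X)
  alternating-denseVertex b     []               = inj₁ refl
  alternating-denseVertex true  {suc m} (true ∷ X) = inj₂ (zero , here , (begin
    suc ∣ X ∣ + suc ∣ X ∣  ≡⟨ cong suc (+-suc ∣ X ∣ ∣ X ∣) ⟩
    2 + (∣ X ∣ + ∣ X ∣)    ≤⟨ +-monoʳ-≤ 2 (+-monoˡ-≤ ∣ X ∣ (∣p∣≤n X)) ⟩
    2 + (m + ∣ X ∣)        ≡⟨ cong (λ Y → 2 + (m + ∣ Y ∣)) (∩-tabulate-true X) ⟨
    2 + (m + ∣ X ∩ tabulate (λ _ → true) ∣) ∎))
    where open ≤-Reasoning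
  alternating-denseVertex false {suc m} (true ∷ X) with alternating-denseVertex true X
  ... | inj₁ ∣X∣≡0 rewrite ∣X∣≡0 = inj₂ (zero , here , s≤s (s≤s z≤n))
  ... | inj₂ (v , v∈X , h) = inj₂ (suc v , there v∈X , (begin
    suc ∣ X ∣ + suc ∣ X ∣  ≡⟨ cong suc (+-suc ∣ X ∣ ∣ X ∣) ⟩
    2 + (∣ X ∣ + ∣ X ∣)    ≤⟨ +-monoʳ-≤ 2 h ⟩
    2 + (1 + m + degIn (Alternating true m) X v) ∎))
    where open ≤-Reasoning
  alternating-denseVertex b     {suc m} (false ∷ X) with alternating-denseVertex (not b) X
  ... | inj₁ ∣X∣≡0 = inj₁ ∣X∣≡0
  ... | inj₂ (v , v∈X , h) = inj₂ (suc v , there v∈X , (begin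
    ∣ X ∣ + ∣ X ∣          ≤⟨ h ⟩
    slack (not b) + m + d  ≤⟨ +-monoˡ-≤ d (+-monoˡ-≤ m (slack-not b)) ⟩
    suc (slack b) + m + d  ≡⟨ cong (_+ d) (+-suc (slack b) m) ⟨
    slack b + suc m + d    ∎))
    where
    open ≤-Reasoning
    d : ℕ
    d = degIn (Alternating (not b) m) X v

  alternating-denseVertex₂ : ∀ b {m} (X : Subset m) →
                             ∣ X ∣ ≡ 0 ⊎ ∃ (DenseVertex (Alternating b m) 2 X)
  alternating-denseVertex₂ b {m} X = Sum.map₂ weaken (alternating-denseVertex b X)
    where
    weaken : ∃ (DenseVertex (Alternating b m) (slack b) X) → ∃ (DenseVertex (Alternating b m) 2 X)
    weaken (v , v∈X , h) = v , v∈X , ≤-trans h (+-monoˡ-≤ _ (+-monoˡ-≤ m (slack≤2 b)))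

module RationalEstimates where

  open import Data.Nat as ℕ using (ℕ)
  open import Data.Nat.Coprimality using (1-coprimeTo) renaming (sym to coprime-sym)
  open import Data.Integer as ℤ using (+_)
  import Data.Integer.Properties as ℤ
  open import Data.Rational using (ℚ; mkℚ; _/_; 0ℚ; 1ℚ; _≤_; _<_; *≤*; _+_; _*_; _-_; _≤?_; positive)
  open import Data.Rational.Properties
  open import Data.Rational.Solver using (module +-*-Solver)
  open import Relation.Nullary using (yes; no; contradiction)
  open ThresholdGraphs using (DenseVertex)

  ℕtoℚ≡mkℚ : ∀ a → ℕtoℚ a ≡ mkℚ (+ a) 0 (coprime-sym (1-coprimeTo a))
  ℕtoℚ≡mkℚ a = normalize-coprime (coprime-sym (1-coprimeTo a))

  ℕtoℚ-+ : ∀ a b → ℕtoℚ (a ℕ.+ b) ≡ ℕtoℚ a + ℕtoℚ b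
  ℕtoℚ-+ a b = sym (begin
    ℕtoℚ a + ℕtoℚ b                    ≡⟨ cong₂ _+_ (ℕtoℚ≡mkℚ a) (ℕtoℚ≡mkℚ b) ⟩
    (+ a ℤ.* + 1 ℤ.+ + b ℤ.* + 1) / 1  ≡⟨ cong (_/ 1) (cong₂ ℤ._+_ (ℤ.*-identityʳ (+ a)) (ℤ.*-identityʳ (+ b))) ⟩
    ℕtoℚ (a ℕ.+ b)                     ∎)
    where open ≡-Reasoning

  ℕtoℚ-mono-≤ : ∀ {a b} → a ℕ.≤ b → ℕtoℚ a ≤ ℕtoℚ b
  ℕtoℚ-mono-≤ {a} {b} a≤b rewrite ℕtoℚ≡mkℚ a | ℕtoℚ≡mkℚ b =
    *≤* (subst₂ ℤ._≤_ (sym (ℤ.*-identityʳ (+ a))) (sym (ℤ.*-identityʳ (+ b))) (ℤ.+≤+ a≤b))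

  +-self-cancel-≤ : ∀ {p q} → p + p ≤ q + q → p ≤ q
  +-self-cancel-≤ {p} {q} p+p≤q+q with p ≤? q
  ... | yes p≤q = p≤q
  ... | no  p≰q = contradiction (<-≤-trans (+-mono-< q<p q<p) p+p≤q+q) (<-irrefl refl)
    where q<p = ≰⇒> p≰q

  MaxDegInducedLe-resp-degIn : ∀ {m} (G H : Graph m) {X : Subset m} {t} →
                               (∀ v → degIn G X v ≡ degIn H X v) →
                               MaxDegInducedLe G X t → MaxDegInducedLe H X t
  MaxDegInducedLe-resp-degIn _ _ {t = t} degG≗degH Δ≤ v v∈X =
    subst (λ k → ℕtoℚ k ≤ t) (degG≗degH v) (Δ≤ v v∈X)

  module DeltaBounds (ε δ : ℚ) (ε≤1 : ε ≤ 1ℚ) (δ[2-ε]≡1 : δ * (ℕtoℚ 2 - ε) ≡ 1ℚ) where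

    δ-nonNeg : 0ℚ ≤ δ
    δ-nonNeg = *-cancelʳ-≤-pos (ℕtoℚ 2 - ε) {{positive 0<2-ε}} (begin
      0ℚ * (ℕtoℚ 2 - ε)  ≡⟨ *-zeroˡ (ℕtoℚ 2 - ε) ⟩
      0ℚ                 ≤⟨ nonNegative⁻¹ 1ℚ ⟩
      1ℚ                 ≡⟨ δ[2-ε]≡1 ⟨
      δ * (ℕtoℚ 2 - ε)   ∎)
      where
      open ≤-Reasoning
      0<2-ε : 0ℚ < ℕtoℚ 2 - ε
      0<2-ε = <-≤-trans (positive⁻¹ 1ℚ) (+-monoʳ-≤ (ℕtoℚ 2) (neg-antimono-≤ ε≤1))

    δN+1-nonNeg : ∀ m → 0ℚ ≤ δ * ℕtoℚ m + 1ℚ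
    δN+1-nonNeg m = +-mono-≤ 0≤δN (nonNegative⁻¹ 1ℚ)
      where
      0≤δN : 0ℚ ≤ δ * ℕtoℚ m
      0≤δN = begin
        0ℚ           ≡⟨ *-zeroˡ (ℕtoℚ m) ⟨
        0ℚ * ℕtoℚ m  ≤⟨ *-monoʳ-≤-nonNeg (ℕtoℚ m) {{normalize-nonNeg m 1}} δ-nonNeg ⟩
        δ * ℕtoℚ m   ∎
        where open ≤-Reasoning

    2+N+εδN≡2[δN+1] : ∀ N → ℕtoℚ 2 + N + ε * δ * N ≡ (δ * N + 1ℚ) + (δ * N + 1ℚ)
    2+N+εδN≡2[δN+1] N = begin
      ℕtoℚ 2 + N + ε * δ * N                     ≡⟨ cong (λ c → ℕtoℚ 2 + c + ε * δ * N) (*-identityˡ N) ⟨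
      ℕtoℚ 2 + 1ℚ * N + ε * δ * N                ≡⟨ cong (λ c → ℕtoℚ 2 + c * N + ε * δ * N) δ[2-ε]≡1 ⟨
      ℕtoℚ 2 + δ * (ℕtoℚ 2 - ε) * N + ε * δ * N  ≡⟨ expand ε δ N ⟩
      (δ * N + 1ℚ) + (δ * N + 1ℚ)                ∎
      where
      open ≡-Reasoning
      open +-*-Solver
      expand : ∀ ε δ N → ℕtoℚ 2 + δ * (ℕtoℚ 2 - ε) * N + ε * δ * N ≡ (δ * N + 1ℚ) + (δ * N + 1ℚ)
      expand = solve 3 (λ ε δ N → con (ℕtoℚ 2) :+ δ :* (con (ℕtoℚ 2) :- ε) :* N :+ ε :* δ :* N
                                  := (δ :* N :+ con 1ℚ) :+ (δ :* N :+ con 1ℚ)) refl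

    sizeBound : ∀ {m} (G : Graph m) {X : Subset m} →
                ∣ X ∣ ≡ 0 ⊎ ∃ (DenseVertex G 2 X) → MaxDegInducedLe G X (ε * δ * ℕtoℚ m) →
                ℕtoℚ ∣ X ∣ ≤ δ * ℕtoℚ m + 1ℚ
    sizeBound {m} _ (inj₁ ∣X∣≡0) _ rewrite ∣X∣≡0 = δN+1-nonNeg m
    sizeBound {m} G {X} (inj₂ (v , v∈X , 2∣X∣≤)) Δ≤ = +-self-cancel-≤ (begin
      ℕtoℚ s + ℕtoℚ s               ≡⟨ ℕtoℚ-+ s s ⟨
      ℕtoℚ (s ℕ.+ s)                ≤⟨ ℕtoℚ-mono-≤ 2∣X∣≤ ⟩
      ℕtoℚ (2 ℕ.+ m ℕ.+ d)          ≡⟨ ℕtoℚ-+ (2 ℕ.+ m) d ⟩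
      ℕtoℚ (2 ℕ.+ m) + ℕtoℚ d       ≤⟨ +-monoʳ-≤ (ℕtoℚ (2 ℕ.+ m)) (Δ≤ v v∈X) ⟩
      ℕtoℚ (2 ℕ.+ m) + ε * δ * N    ≡⟨ cong (_+ ε * δ * N) (ℕtoℚ-+ 2 m) ⟩
      ℕtoℚ 2 + N + ε * δ * N        ≡⟨ 2+N+εδN≡2[δN+1] N ⟩
      (δ * N + 1ℚ) + (δ * N + 1ℚ)   ∎)
      where
      open ≤-Reasoning
      s : ℕ
      s = ∣ X ∣
      N : ℚ
      N = ℕtoℚ m
      d : ℕ
      d = degIn G X v

open ThresholdGraphs using (Alternating; alternating-isCograph; alternating-denseVertex₂; degIn-complement-Alternating)
open RationalEstimates using (MaxDegInducedLe-resp-degIn; module DeltaBounds)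

open import Function using (_∘_)
open import Data.Sum using ([_,_])
open import Data.Nat using (ℕ; _≥_)
open import Data.Rational using (ℚ; ½; 1ℚ; _≤_; _*_; _+_; _-_)

mainTheorem11 : (ε δ : ℚ) → ½ ≤ ε → ε ≤ 1ℚ → δ * (ℕtoℚ 2 - ε) ≡ 1ℚ →
    (n : ℕ) → n ≥ 2 →
    Σ (Graph (2 Data.Nat.* n)) λ G → IsCograph G ×
      ((X : Subset (2 Data.Nat.* n)) →
        (MaxDegInducedLe G X (ε * δ * ℕtoℚ (2 Data.Nat.* n))
          ⊎ MaxDegInducedLe (complement G) X (ε * δ * ℕtoℚ (2 Data.Nat.* n))) →
        ℕtoℚ ∣ X ∣ ≤ δ * ℕtoℚ (2 Data.Nat.* n) + 1ℚ)
mainTheorem11 ε δ _ ε≤1 δ[2-ε]≡1 n _ = Alternating true m , alternating-isCograph true , λ X →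
  [ sizeBound (Alternating true m) (alternating-denseVertex₂ true X)
  , sizeBound (Alternating false m) (alternating-denseVertex₂ false X)
      ∘ MaxDegInducedLe-resp-degIn (complement (Alternating true m)) (Alternating false m)
          (degIn-complement-Alternating true X)
  ]
  where
  open DeltaBounds ε δ ε≤1 δ[2-ε]≡1 using (sizeBound)
  m : ℕ
  m = 2 Data.Nat.* n
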